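{- Let $t\ge1$ and $\pi\in\mathfrak{S}_n(321)$. Then $\pi$ avoids the pattern $23\cdots(t+2)1$ if and only if $\mathsf{mlw}(\pi)\le t$. Consequently, $\mathfrak{S}_n^t(321)=\mathfrak{S}_n(321,\,23\cdots(t+2)1)$.
   Context: $\mathfrak{S}_n(P)$ is the set of permutations of $[n]$ avoiding all patterns in $P$. Stack-sorting: $\mathcal{S}(\emptyset)=\emptyset$, $\mathcal{S}(\alpha\,m\,\beta)=\mathcal{S}(\alpha)\mathcal{S}(\beta)m$ with $m$ the largest letter; $\mathfrak{S}_n^t(321)$ is the set of $\pi\in\mathfrak{S}_n(321)$ with $\mathcal{S}^t(\pi)$ the identity. $\mathsf{Rmi}(\pi)$ is the set of right-to-left minima $\pi_j$ ($\pi_j<\pi_k$ for all $k>j$), and $\mathsf{mlw}(\pi)=\max_{\pi_j\in\mathsf{Rmi}(\pi)}(j-\pi_j)$. -}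

module Defs where

open import Data.Nat using (ℕ; zero; suc; _+_; _∸_; _<_; _≤_; _⊔_; _<ᵇ_; _≡ᵇ_)
open import Data.Bool using (Bool; true; false; if_then_else_)
open import Data.List using (List; []; _∷_; _++_; [_]; length; map; upTo; filterᵇ; foldr; drop; applyUpTo)
open import Data.List.Relation.Binary.Sublist.Propositional using (_⊆_)
open import Data.List.Relation.Binary.Permutation.Propositional using (_↭_)
open import Data.Product using (Σ; _×_; _,_; proj₁; proj₂)
open import Function.Bundles using (_⇔_)
open import Relation.Nullary using (¬_)
open import Relation.Binary.PropositionalEquality using (_≡_)

-- Permutations of [n] are words (lists) in one-line notation with letters 1..n.
-- `at π i` is the letter in 0-based position i (default 0 outside the range).
at : List ℕ → ℕ → ℕ
at []       _       = 0
at (x ∷ xs) zero    = x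
at (x ∷ xs) (suc i) = at xs i

idPerm : ℕ → List ℕ
idPerm n = map suc (upTo n)

IsPerm : ℕ → List ℕ → Set
IsPerm n π = π ↭ idPerm n

OrderIso : List ℕ → List ℕ → Set
OrderIso σ p = (length σ ≡ length p) ×
  (∀ i j → i < length σ → j < length σ → ((at σ i < at σ j) ⇔ (at p i < at p j)))

Contains : List ℕ → List ℕ → Set
Contains π p = Σ (List ℕ) (λ σ → (σ ⊆ π) × OrderIso σ p)

Avoids : List ℕ → List ℕ → Set
Avoids π p = ¬ Contains π p

p321 : List ℕ
p321 = 3 ∷ 2 ∷ 1 ∷ []

pat : ℕ → List ℕ
pat t = map (λ k → 2 + k) (upTo (suc t)) ++ [ 1 ]

Av321 : ℕ → List ℕ → Set
Av321 n π = IsPerm n π × Avoids π p321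

maxL : List ℕ → ℕ
maxL = foldr _⊔_ 0

splitAt : ℕ → List ℕ → List ℕ × List ℕ
splitAt m [] = [] , []
splitAt m (x ∷ xs) with x ≡ᵇ m
... | true  = [] , xs
... | false = let r = splitAt m xs in (x ∷ proj₁ r) , proj₂ r

-- fuel-bounded version; fuel ≥ length suffices
stackSortF : ℕ → List ℕ → List ℕ
stackSortF zero    _  = []
stackSortF (suc k) [] = []
stackSortF (suc k) xs@(_ ∷ _) =
  let m = maxL xs
      r = splitAt m xs
  in stackSortF k (proj₁ r) ++ stackSortF k (proj₂ r) ++ [ m ]

stackSort : List ℕ → List ℕ
stackSort xs = stackSortF (length xs) xs

stackSortIter : ℕ → List ℕ → List ℕ
stackSortIter zero    π = π
stackSortIter (suc t) π = stackSort (stackSortIter t π)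

Sorted321 : ℕ → ℕ → List ℕ → Set
Sorted321 t n π = Av321 n π × (stackSortIter t π ≡ idPerm n)

allB : (ℕ → Bool) → List ℕ → Bool
allB p []       = true
allB p (x ∷ xs) = if p x then allB p xs else false

isRmi : List ℕ → ℕ → Bool
isRmi π j = allB (λ k → at π j <ᵇ at π k) (applyUpTo (λ i → suc j + i) (length π ∸ suc j))

-- mlw(π) = max over right-to-left minima π_j (1-based j) of (j - π_j)
mlw : List ℕ → ℕ
mlw π = maxL (map (λ j → suc j ∸ at π j) (filterᵇ (isRmi π) (upTo (length π))))

-- Call an occurrence of 2 3 ⋯ (k+2) 1 a k-occurrence. In a 321-avoiding permutation, one pass of stack
-- sorting turns every (k+1)-occurrence into a k-occurrence (the ascent loses at most the maximum m), and
-- every k-occurrence of S(π) comes from a (k+1)-occurrence of π (to which m is appended). Since S keeps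
-- 321-avoidance and a 0-occurrence is just an inversion, S^t(π) is the identity iff π has no t-occurrence.
-- For mlw: if x = π_j is preceded by more than t + (x − 1) letters, more than t of them exceed x and,
-- by 321-avoidance, increase, giving a t-occurrence; conversely the 1 of a t-occurrence is a
-- right-to-left minimum preceded by its ascent and by all of 1, …, x − 1, so j − x > t.
module Submission where

open import Defs
open import Data.Nat using (ℕ; zero; suc; _+_; _∸_; _<_; _>_; _≤_; _⊔_; _<ᵇ_; _≡ᵇ_; z≤n; s≤s; _<?_)
open import Data.Nat.Properties
open import Data.Bool using (true; false; T)
open import Data.Bool.Properties using (T-≡)
open import Relation.Nullary.Decidable using (T?)
open import Data.List using (List; []; _∷_; initLast; _∷ʳ′_; filter; _++_; [_]; length; map; upTo;
  filterᵇ; take; applyUpTo)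
open import Data.List.Properties using (∷-injective; ∷-injectiveʳ; ++-conicalʳ; length-++-sucʳ;
  ++-assoc; ++-identityʳ; length-++; length-map; length-upTo; length-take; map-upTo;
  foldr-preservesᵇ; foldr-forcesᵇ)
open import Data.List.Membership.Propositional using (_∈_)
open import Data.List.Membership.Propositional.Properties using (∈-map⁺; ∈-map⁻; ∈-filter⁺;
  ∈-filter⁻; ∈-++⁺ˡ; ∈-++⁺ʳ; ∈-++⁻; ∈-∃++; ∈-applyUpTo⁺; ∈-applyUpTo⁻; ∈-upTo⁺; ∈-upTo⁻)
open import Data.List.Relation.Unary.Any using (here; there)
open import Data.List.Relation.Unary.All as All using (All; []; _∷_)
import Data.List.Relation.Unary.All.Properties as All
open import Data.List.Relation.Unary.AllPairs as AllPairs using (AllPairs; []; _∷_)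
import Data.List.Relation.Unary.AllPairs.Properties as AllPairs
open import Data.List.Relation.Unary.Unique.Propositional using (Unique)
open import Data.List.Relation.Binary.Sublist.Propositional using (_⊆_; []; _∷_; _∷ʳ_; ⊆-refl;
  ⊆-trans; from∈) renaming (lookup to ∈-resp-⊆)
open import Data.List.Relation.Binary.Sublist.Propositional.Properties using (++⁺; ++⁺ˡ; ++⁺ʳ;
  []⊆-universal; take-⊆; filter-⊆; All-resp-⊆)
open import Data.List.Relation.Binary.Permutation.Propositional using (_↭_; ↭-refl; ↭-sym; ↭-trans; ↭⇒↭ₛ)
open import Data.List.Relation.Binary.Permutation.Propositional.Properties
  using (∈-resp-↭; ++-comm) renaming (++⁺ to ↭-++⁺; ++⁺ʳ to ↭-++⁺ʳ)
import Data.List.Relation.Binary.Permutation.Setoid.Properties as SetoidPermutation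
open import Data.List.Relation.Unary.Sorted.TotalOrder.Properties using (AllPairs⇒Sorted; ↗↭↗⇒≋)
open import Data.List.Relation.Binary.Equality.Propositional using (≋⇒≡)
open import Data.Product using (∃; ∃₂; _×_; _,_; proj₁; proj₂)
open import Data.Sum using (_⊎_; inj₁; inj₂)
open import Data.Empty using (⊥; ⊥-elim)
open import Data.Unit using (tt)
open import Function.Base using (_∘′_; case_of_)
open import Function.Properties.Equivalence using () renaming (sym to ⇔-sym; trans to ⇔-trans)
open import Function.Bundles using (_⇔_; mk⇔; Equivalence)
open import Relation.Nullary using (¬_; yes; no)
open import Relation.Binary.Definitions using (tri<; tri≈; tri>)
open import Relation.Binary.PropositionalEquality using (_≡_; _≢_; refl; sym; trans; cong; subst;
  subst₂; setoid)

private
  variable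
    A : Set

open Equivalence using (to; from)

⊆-++-split : ∀ {ws : List A} as bs → ws ⊆ as ++ bs →
  ∃₂ λ w₁ w₂ → ws ≡ w₁ ++ w₂ × w₁ ⊆ as × w₂ ⊆ bs
⊆-++-split [] bs s = [] , _ , refl , [] , s
⊆-++-split (a ∷ as) bs (.a ∷ʳ s) with ⊆-++-split as bs s
... | w₁ , w₂ , refl , s₁ , s₂ = w₁ , w₂ , refl , a ∷ʳ s₁ , s₂
⊆-++-split (a ∷ as) bs (refl ∷ s) with ⊆-++-split as bs s
... | w₁ , w₂ , refl , s₁ , s₂ = a ∷ w₁ , w₂ , refl , refl ∷ s₁ , s₂

⊆-singleton : ∀ {ws : List A} {m} → ws ⊆ [ m ] → ws ≡ [] ⊎ ws ≡ [ m ]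
⊆-singleton (_ ∷ʳ []) = inj₁ refl
⊆-singleton (refl ∷ []) = inj₂ refl

head∈ : ∀ {x : A} {xs ys} → x ∷ xs ⊆ ys → x ∈ ys
head∈ s = ∈-resp-⊆ s (here refl)

pair-⊆-++ : ∀ {a b : A} {xs ys} → a ∈ xs → b ∈ ys → a ∷ b ∷ [] ⊆ xs ++ ys
pair-⊆-++ i j = ++⁺ (from∈ i) (from∈ j)

snoc-⊆ : ∀ (ys : List A) {x π} → ys ++ [ x ] ⊆ π → ∃₂ λ p q → π ≡ p ++ x ∷ q × ys ⊆ p
snoc-⊆ [] s with ∈-∃++ (head∈ s)
... | p , q , e = p , q , e , []⊆-universal p
snoc-⊆ (y ∷ ys) (y′ ∷ʳ s) with snoc-⊆ (y ∷ ys) s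
... | p , q , refl , t = y′ ∷ p , q , refl , y′ ∷ʳ t
snoc-⊆ (y ∷ ys) (refl ∷ s) with snoc-⊆ ys s
... | p , q , refl , t = y ∷ p , q , refl , refl ∷ t

++-≡-++-∷ : ∀ (xs ys p : List A) x q → xs ++ ys ≡ p ++ x ∷ q →
  (∃ λ q′ → xs ≡ p ++ x ∷ q′ × q ≡ q′ ++ ys) ⊎ (∃ λ p′ → p ≡ xs ++ p′ × ys ≡ p′ ++ x ∷ q)
++-≡-++-∷ [] ys p x q e = inj₂ (p , refl , e)
++-≡-++-∷ (_ ∷ xs) ys [] x q refl = inj₁ (xs , refl , refl)
++-≡-++-∷ (_ ∷ xs) ys (_ ∷ p) x q e with ∷-injective e
... | refl , e′ with ++-≡-++-∷ xs ys p x q e′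
...   | inj₁ (q′ , refl , refl) = inj₁ (q′ , refl , refl)
...   | inj₂ (p′ , refl , refl) = inj₂ (p′ , refl , refl)

length-snoc : ∀ (xs : List A) x → length (xs ++ [ x ]) ≡ suc (length xs)
length-snoc xs x = trans (length-++ xs) (+-comm (length xs) 1)

∈-delete : ∀ {z x : A} xs {ys} → z ∈ xs ++ x ∷ ys → z ≢ x → z ∈ xs ++ ys
∈-delete [] (here z≡x) z≢x = ⊥-elim (z≢x z≡x)
∈-delete [] (there i) _ = i
∈-delete (_ ∷ xs) (here refl) _ = here refl
∈-delete (_ ∷ xs) (there i) z≢x = there (∈-delete xs i z≢x)

AllPairs-resp-⊆ : ∀ {R : A → A → Set} {xs ys} → xs ⊆ ys → AllPairs R ys → AllPairs R xs
AllPairs-resp-⊆ [] _ = []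
AllPairs-resp-⊆ (y ∷ʳ s) (_ ∷ ps) = AllPairs-resp-⊆ s ps
AllPairs-resp-⊆ (refl ∷ s) (p ∷ ps) = All-resp-⊆ s p ∷ AllPairs-resp-⊆ s ps

AllPairs-pair : ∀ {R : A → A → Set} {a b xs} → a ∷ b ∷ [] ⊆ xs → AllPairs R xs → R a b
AllPairs-pair s ps with AllPairs-resp-⊆ s ps
... | (r ∷ []) ∷ _ = r

pairs⇒AllPairs : ∀ {R : A → A → Set} xs → (∀ {a b} → a ∷ b ∷ [] ⊆ xs → R a b) → AllPairs R xs
pairs⇒AllPairs [] _ = []
pairs⇒AllPairs (x ∷ xs) r = All.tabulate (λ i → r (refl ∷ from∈ i)) ∷ pairs⇒AllPairs xs (λ s → r (x ∷ʳ s))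

Unique-resp-↭ : ∀ {xs ys : List A} → xs ↭ ys → Unique xs → Unique ys
Unique-resp-↭ p = SetoidPermutation.Unique-resp-↭ (setoid _) (↭⇒↭ₛ p)

Unique⇒length-mono : ∀ {xs ys : List A} → Unique xs → (∀ {z} → z ∈ xs → z ∈ ys) → length xs ≤ length ys
Unique⇒length-mono {xs = []} _ _ = z≤n
Unique⇒length-mono {xs = x ∷ xs} (x∉xs ∷ u) f with ∈-∃++ (f (here refl))
... | ys₁ , ys₂ , refl = subst (suc (length xs) ≤_) (sym (length-++-sucʳ ys₁ x ys₂))
  (s≤s (Unique⇒length-mono u (λ i → ∈-delete ys₁ (f (there i)) (λ z≡x → All.lookup x∉xs i (sym z≡x)))))

maxL≤⇔All : ∀ {t} xs → (maxL xs ≤ t) ⇔ All (_≤ t) xs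
maxL≤⇔All xs = mk⇔ (foldr-forcesᵇ (λ x y → ⊔-lub⁻ x y) 0 xs) (foldr-preservesᵇ ⊔-lub z≤n)
  where
  ⊔-lub⁻ : ∀ {t} x y → x ⊔ y ≤ t → x ≤ t × y ≤ t
  ⊔-lub⁻ x y h = m⊔n≤o⇒m≤o x y h , m⊔n≤o⇒n≤o x y h

≤maxL : ∀ {x xs} → x ∈ xs → x ≤ maxL xs
≤maxL {xs = xs} = All.lookup (to (maxL≤⇔All xs) ≤-refl)

maxL-∈ : ∀ y ys → maxL (y ∷ ys) ∈ y ∷ ys
maxL-∈ y [] = here (⊔-identityʳ y)
maxL-∈ y (z ∷ zs) with ⊔-sel y (maxL (z ∷ zs))
... | inj₁ e = here e
... | inj₂ e = there (subst (_∈ z ∷ zs) (sym e) (maxL-∈ z zs))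

splitAt-correct : ∀ m xs → m ∈ xs → xs ≡ proj₁ (splitAt m xs) ++ m ∷ proj₂ (splitAt m xs)
splitAt-correct m (x ∷ xs) i with x ≡ᵇ m in e
... | true = cong (_∷ xs) (≡ᵇ⇒≡ x m (subst T (sym e) tt))
splitAt-correct m (x ∷ xs) (here refl) | false = ⊥-elim (subst T e (≡⇒≡ᵇ x x refl))
splitAt-correct m (x ∷ xs) (there i) | false = cong (x ∷_) (splitAt-correct m xs i)

idPerm-increasing : ∀ n → AllPairs _<_ (idPerm n)
idPerm-increasing n = subst (AllPairs _<_) (sym (map-upTo suc n)) (AllPairs.applyUpTo⁺₁ suc n (λ i<j _ → s≤s i<j))

length-idPerm : ∀ n → length (idPerm n) ≡ n
length-idPerm n = trans (length-map suc (upTo n)) (length-upTo n)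

∈-idPerm⁻ : ∀ {n z} → z ∈ idPerm n → 1 ≤ z × z ≤ n
∈-idPerm⁻ {n} i with ∈-applyUpTo⁻ suc (subst (_ ∈_) (map-upTo suc n) i)
... | k , k<n , refl = s≤s z≤n , k<n

∈-idPerm⁺ : ∀ {n z} → 1 ≤ z → z ≤ n → z ∈ idPerm n
∈-idPerm⁺ {n} {suc k} _ k<n = subst (_ ∈_) (sym (map-upTo suc n)) (∈-applyUpTo⁺ suc k<n)

↭-idPerm⇒Unique : ∀ {n ρ} → ρ ↭ idPerm n → Unique ρ
↭-idPerm⇒Unique {n} p = Unique-resp-↭ (↭-sym p) (AllPairs.map <⇒≢ (idPerm-increasing n))

↭-idPerm-increasing⇒≡ : ∀ {n ρ} → ρ ↭ idPerm n → AllPairs _<_ ρ → ρ ≡ idPerm n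
↭-idPerm-increasing⇒≡ {n} p ρ↑ = ≋⇒≡ (↗↭↗⇒≋ ≤-totalOrder (sorted ρ↑) (sorted (idPerm-increasing n)) (↭⇒↭ₛ p))
  where sorted = λ {xs} (xs↑ : AllPairs _<_ xs) → AllPairs⇒Sorted ≤-totalOrder (AllPairs.map <⇒≤ xs↑)

data StackSort : List ℕ → List ℕ → Set where
  []   : StackSort [] []
  node : ∀ {α m β Sα Sβ} → (∀ {z} → z ∈ α ++ m ∷ β → z ≤ m) →
         StackSort α Sα → StackSort β Sβ → StackSort (α ++ m ∷ β) (Sα ++ Sβ ++ [ m ])

stackSortF-graph : ∀ k xs → length xs ≤ k → StackSort xs (stackSortF k xs)
stackSortF-graph zero [] _ = []
stackSortF-graph (suc k) [] _ = []
stackSortF-graph (suc k) (y ∷ ys) |xs|≤1+k =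
  subst (λ l → StackSort l (stackSortF k α ++ stackSortF k β ++ [ m ])) (sym split)
    (node (λ i → ≤maxL (subst (_ ∈_) (sym split) i))
          (stackSortF-graph k α (≤-pred (≤-trans (s≤s (m≤m+n (length α) (length β))) |xs|≤1+k′)))
          (stackSortF-graph k β (≤-pred (≤-trans (s≤s (m≤n+m (length β) (length α))) |xs|≤1+k′))))
  where
  m = maxL (y ∷ ys)
  α = proj₁ (splitAt m (y ∷ ys))
  β = proj₂ (splitAt m (y ∷ ys))
  split : y ∷ ys ≡ α ++ m ∷ β
  split = splitAt-correct m (y ∷ ys) (maxL-∈ y ys)
  |xs|≤1+k′ : suc (length α + length β) ≤ suc k
  |xs|≤1+k′ = subst (_≤ suc k) (trans (cong length split) (trans (length-++-sucʳ α m β) (cong suc (length-++ α))))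
                |xs|≤1+k

stackSort-graph : ∀ xs → StackSort xs (stackSort xs)
stackSort-graph xs = stackSortF-graph (length xs) xs ≤-refl

StackSort-↭ : ∀ {xs ys} → StackSort xs ys → ys ↭ xs
StackSort-↭ [] = ↭-refl
StackSort-↭ (node {m = m} {β} _ sα sβ) =
  ↭-++⁺ (StackSort-↭ sα) (↭-trans (↭-++⁺ʳ [ m ] (StackSort-↭ sβ)) (++-comm β [ m ]))

StackSort-∈⁻ : ∀ {xs ys z} → StackSort xs ys → z ∈ ys → z ∈ xs
StackSort-∈⁻ s = ∈-resp-↭ (StackSort-↭ s)

StackSort-∈⁺ : ∀ {xs ys z} → StackSort xs ys → z ∈ xs → z ∈ ys
StackSort-∈⁺ s = ∈-resp-↭ (↭-sym (StackSort-↭ s))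

StackSort-preserves-increasing : ∀ {xs ys zs} → StackSort xs ys → AllPairs _<_ zs → zs ⊆ xs → zs ⊆ ys
StackSort-preserves-increasing [] _ s = s
StackSort-preserves-increasing (node {α} {m} {β} {Sβ = Sβ} m-max sα sβ) inc s
  with ⊆-++-split α (m ∷ β) s
... | w₁ , w₂ , refl , s₁ , s₂ =
  ++⁺ (StackSort-preserves-increasing sα (AllPairs-resp-⊆ (++⁺ʳ w₂ ⊆-refl) inc) s₁)
      (tail w₂ s₂ (AllPairs-resp-⊆ (++⁺ˡ w₁ ⊆-refl) inc))
  where
  tail : ∀ ws → ws ⊆ m ∷ β → AllPairs _<_ ws → ws ⊆ Sβ ++ [ m ]
  tail ws (.m ∷ʳ t) inc′ = ++⁺ʳ [ m ] (StackSort-preserves-increasing sβ inc′ t)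
  tail (.m ∷ []) (refl ∷ t) _ = ++⁺ˡ Sβ ⊆-refl
  tail (.m ∷ z ∷ _) (refl ∷ t) ((m<z ∷ _) ∷ _) =
    ⊥-elim (<⇒≱ m<z (m-max (∈-++⁺ʳ α (there (head∈ t)))))

last-of-decreasing : ∀ {us m} → AllPairs _>_ (us ++ [ m ]) → All (_≤ m) us → us ≡ []
last-of-decreasing {[]} _ _ = refl
last-of-decreasing {u ∷ us} (u>rest ∷ _) (u≤m ∷ _) = ⊥-elim (<⇒≱ (All.lookup u>rest (∈-++⁺ʳ us (here refl))) u≤m)

StackSort-reflects-decreasing : ∀ {xs ys zs} → StackSort xs ys → AllPairs _>_ zs → zs ⊆ ys → zs ⊆ xs
StackSort-reflects-decreasing [] _ s = s
StackSort-reflects-decreasing S@(node {α} {m} {β} {Sα} {Sβ} m-max sα sβ) dec s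
  with ⊆-++-split Sα (Sβ ++ [ m ]) s
... | w₁ , w₂ , refl , s₁ , s₂ with ⊆-++-split Sβ [ m ] s₂
... | v₁ , v₂ , refl , t₁ , t₂ with ⊆-singleton t₂
... | inj₁ refl = ++⁺ (StackSort-reflects-decreasing sα (AllPairs-resp-⊆ (++⁺ʳ _ ⊆-refl) dec) s₁)
        (m ∷ʳ StackSort-reflects-decreasing {zs = v₁ ++ []} sβ (AllPairs-resp-⊆ (++⁺ˡ w₁ ⊆-refl) dec)
                (subst (_⊆ Sβ) (sym (++-identityʳ v₁)) t₁))
... | inj₂ refl = subst (_⊆ α ++ m ∷ β) (trans (cong (_++ [ m ]) (sym prefix-empty)) (++-assoc w₁ v₁ [ m ]))
                        (++⁺ˡ α (refl ∷ []⊆-universal β))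
  where
  zs≤m : All (_≤ m) (w₁ ++ v₁ ++ [ m ])
  zs≤m = All.tabulate λ i → m-max (StackSort-∈⁻ S (∈-resp-⊆ s i))
  prefix-empty : w₁ ++ v₁ ≡ []
  prefix-empty = last-of-decreasing (subst (AllPairs _>_) (sym (++-assoc w₁ v₁ [ m ])) dec)
                   (All-resp-⊆ (++⁺ {as = w₁} ⊆-refl (++⁺ʳ [ m ] ⊆-refl)) zs≤m)

No321 : List ℕ → Set
No321 ρ = ∀ {a b c} → a ∷ b ∷ c ∷ [] ⊆ ρ → b < a → c < b → ⊥

No321-resp-⊆ : ∀ {xs ys} → xs ⊆ ys → No321 ys → No321 xs
No321-resp-⊆ s n321 t = n321 (⊆-trans t s)

StackSort-preserves-No321 : ∀ {xs ys} → StackSort xs ys → No321 xs → No321 ys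
StackSort-preserves-No321 s n321 t b<a c<b =
  n321 (StackSort-reflects-decreasing s ((b<a ∷ <-trans c<b b<a ∷ []) ∷ (c<b ∷ []) ∷ [] ∷ []) t) b<a c<b

above-before-No321 : ∀ {ys x} → No321 (ys ++ [ x ]) → Unique ys → All (x <_) ys → AllPairs _<_ ys
above-before-No321 {ys} n321 u above = pairs⇒AllPairs ys ordered
  where
  ordered : ∀ {a b} → a ∷ b ∷ [] ⊆ ys → a < b
  ordered {a} {b} ab⊆ys with <-cmp a b
  ... | tri< a<b _ _ = a<b
  ... | tri≈ _ a≡b _ = ⊥-elim (AllPairs-pair ab⊆ys u a≡b)
  ... | tri> _ _ b<a = ⊥-elim (n321 (++⁺ ab⊆ys ⊆-refl) b<a (All.lookup above (∈-resp-⊆ ab⊆ys (there (here refl)))))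

-- An occurrence of the pattern 2 3 ⋯ (k+2) 1 in ρ, the 1 being the letter `low`.
-- The ascent may have more than k + 1 letters.
record Occurrence (k : ℕ) (ρ : List ℕ) : Set where
  constructor occurrence
  field
    {before}          : List ℕ
    {low}             : ℕ
    {after}           : List ℕ
    {ascent}          : List ℕ
    split             : ρ ≡ before ++ low ∷ after
    ascent⊆before     : ascent ⊆ before
    ascent-increasing : AllPairs _<_ ascent
    ascent-above      : All (low <_) ascent
    ascent-long       : k < length ascent

Occurrence-++ : ∀ {k zs x} xs {ys} → zs ⊆ xs → AllPairs _<_ zs → All (x <_) zs → k < length zs →
  x ∈ ys → Occurrence k (xs ++ ys)
Occurrence-++ xs s inc above long x∈ys with ∈-∃++ x∈ys
... | ys₁ , ys₂ , refl = occurrence (sym (++-assoc xs ys₁ _)) (++⁺ʳ ys₁ s) inc above long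

Occurrence-++ʳ : ∀ {k xs} ys → Occurrence k xs → Occurrence k (xs ++ ys)
Occurrence-++ʳ ys (occurrence {p} {x} {q} refl s inc above long) =
  occurrence (++-assoc p (x ∷ q) ys) s inc above long

Occurrence-∷ : ∀ {k xs} a → Occurrence k xs → Occurrence k (a ∷ xs)
Occurrence-∷ a (occurrence refl s inc above long) = occurrence refl (a ∷ʳ s) inc above long

¬Occurrence-[] : ∀ {k} → ¬ Occurrence k []
¬Occurrence-[] (occurrence {[]} () _ _ _ _)
¬Occurrence-[] (occurrence {_ ∷ _} () _ _ _ _)

Occurrence-low< : ∀ {k ρ m} (o : Occurrence k ρ) → (∀ {z} → z ∈ ρ → z ≤ m) → Occurrence.low o < m
Occurrence-low< (occurrence {p} {x} {q} {z ∷ _} refl s _ (x<z ∷ _) _) ρ≤m =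
  <-≤-trans x<z (ρ≤m (∈-++⁺ˡ (head∈ s)))

module BelowMax {α β : List ℕ} {m : ℕ}
  (m-max : ∀ {z} → z ∈ α ++ m ∷ β → z ≤ m) (u : Unique (α ++ m ∷ β)) where

  α<m : ∀ {z} → z ∈ α → z < m
  α<m i = ≤∧≢⇒< (m-max (∈-++⁺ˡ i)) (AllPairs-pair (pair-⊆-++ i (here refl)) u)

  β<m : ∀ {z} → z ∈ β → z < m
  β<m i = ≤∧≢⇒< (m-max (∈-++⁺ʳ α (there i))) (λ z≡m → AllPairs-pair (++⁺ˡ α (refl ∷ from∈ i)) u (sym z≡m))

none-above : ∀ {ws ys : List ℕ} {x} → ws ⊆ ys → All (x <_) ws → (∀ {z} → z ∈ ys → z ≤ x) → ws ≡ []
none-above {[]} _ _ _ = refl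
none-above {_ ∷ _} s (x<w ∷ _) ys≤x = ⊥-elim (<⇒≱ x<w (ys≤x (head∈ s)))

at-most-one-above : ∀ {ws ys : List ℕ} {m x} → ws ⊆ m ∷ ys → All (x <_) ws → (∀ {z} → z ∈ ys → z ≤ x) →
  length ws ≤ 1
at-most-one-above (_ ∷ʳ s) above ys≤x rewrite none-above s above ys≤x = z≤n
at-most-one-above (refl ∷ s) (_ ∷ above) ys≤x rewrite none-above s above ys≤x = s≤s z≤n

-- The letters of the ascent lying to the right of m must be m itself (else m, a, low would be a 321),
-- so S loses at most one letter of the ascent; the rest is an increasing subsequence of α, kept by S.
occurrence-after-StackSort : ∀ {j xs ys} → StackSort xs ys → Unique xs → No321 xs →
  Occurrence (suc j) xs → Occurrence j ys
occurrence-after-StackSort [] _ _ o = ⊥-elim (¬Occurrence-[] o)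
occurrence-after-StackSort {j} (node {α} {m} {β} {Sα} {Sβ} m-max sα sβ) u n321
  o@(occurrence {p} {x} {q} split s inc above long) with ++-≡-++-∷ α (m ∷ β) p x q split
... | inj₁ (q′ , refl , refl) =
  Occurrence-++ʳ (Sβ ++ [ m ]) (occurrence-after-StackSort sα (AllPairs-resp-⊆ α⊆xs u)
    (No321-resp-⊆ α⊆xs n321) (occurrence refl s inc above long))
  where α⊆xs = ++⁺ʳ (m ∷ β) ⊆-refl
... | inj₂ ([] , refl , refl) = ⊥-elim (<-irrefl refl (Occurrence-low< o m-max))
... | inj₂ (.m ∷ p″ , refl , refl) with ⊆-++-split α (m ∷ p″) s
...   | w₁ , w₂ , refl , s₁ , s₂ =
  Occurrence-++ Sα (StackSort-preserves-increasing sα inc₁ s₁) inc₁ (All.++⁻ˡ w₁ above) long₁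
    (∈-++⁺ˡ (StackSort-∈⁺ sβ (∈-++⁺ʳ p″ (here refl))))
  where
  open BelowMax m-max u
  inc₁ : AllPairs _<_ w₁
  inc₁ = AllPairs-resp-⊆ (++⁺ʳ w₂ ⊆-refl) inc
  p″≤x : ∀ {z} → z ∈ p″ → z ≤ x
  p″≤x i = ≮⇒≥ λ x<z →
    n321 (++⁺ˡ α (refl ∷ ++⁺ (from∈ i) (refl ∷ []⊆-universal q))) (β<m (∈-++⁺ˡ i)) x<z
  long₁ : j < length w₁
  long₁ = ≤-pred (begin
    suc (suc j)           ≤⟨ long ⟩
    length (w₁ ++ w₂)     ≡⟨ length-++ w₁ ⟩
    length w₁ + length w₂ ≤⟨ +-monoʳ-≤ (length w₁) (at-most-one-above s₂ (All.++⁻ʳ w₁ above) p″≤x) ⟩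
    length w₁ + 1         ≡⟨ +-comm (length w₁) 1 ⟩
    suc (length w₁)       ∎)
    where open ≤-Reasoning

increasing-⊆ : ∀ {zs} α → AllPairs _<_ zs → (∀ {z} → z ∈ zs → z ∈ α) →
  (∀ {a b} → a ∷ b ∷ [] ⊆ α → b < a → a ∈ zs → b ∈ zs → ⊥) → zs ⊆ α
increasing-⊆ {[]} α _ _ _ = []⊆-universal α
increasing-⊆ {z ∷ zs} [] _ zs⊆α _ with () ← zs⊆α (here refl)
increasing-⊆ {z ∷ zs} (a ∷ α) (z<zs ∷ inc) zs⊆α no-inv with z ≟ a
... | yes refl = refl ∷ increasing-⊆ α inc tail⊆α (λ t b<a i j → no-inv (z ∷ʳ t) b<a (there i) (there j))
  where
  tail⊆α : ∀ {w} → w ∈ zs → w ∈ α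
  tail⊆α i with zs⊆α (there i)
  ... | here refl = ⊥-elim (<-irrefl refl (All.lookup z<zs i))
  ... | there j = j
... | no z≢a = a ∷ʳ increasing-⊆ α (z<zs ∷ inc) ⊆α (λ t → no-inv (a ∷ʳ t))
  where
  z∈α : z ∈ α
  z∈α with zs⊆α (here refl)
  ... | here z≡a = ⊥-elim (z≢a z≡a)
  ... | there j = j
  ⊆α : ∀ {w} → w ∈ z ∷ zs → w ∈ α
  ⊆α i with zs⊆α i
  ... | there j = j
  ⊆α (here refl) | here z≡a = ⊥-elim (z≢a z≡a)
  ⊆α (there i) | here refl = ⊥-elim (no-inv (refl ∷ from∈ z∈α) (All.lookup z<zs i) (there i) (here refl))

-- If the 1 sits in S(β), no letter of the ascent can come from S(β) (that would give m, a, low as a 321),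
-- so the whole ascent comes from S(α), sits in α in the same order, and m can be appended to it.
occurrence-before-StackSort : ∀ {j xs ys} → StackSort xs ys → Unique xs → No321 xs →
  Occurrence j ys → Occurrence (suc j) xs
occurrence-before-StackSort [] _ _ o = ⊥-elim (¬Occurrence-[] o)
occurrence-before-StackSort {j} S@(node {α} {m} {β} {Sα} {Sβ} m-max sα sβ) u n321
  o@(occurrence {p} {x} {q} split t inc above long) with ++-≡-++-∷ Sα (Sβ ++ [ m ]) p x q split
... | inj₁ (q′ , refl , refl) =
  Occurrence-++ʳ (m ∷ β) (occurrence-before-StackSort sα (AllPairs-resp-⊆ α⊆xs u)
    (No321-resp-⊆ α⊆xs n321) (occurrence refl t inc above long))
  where α⊆xs = ++⁺ʳ (m ∷ β) ⊆-refl
... | inj₂ (p′ , refl , e) with ++-≡-++-∷ Sβ [ m ] p′ x q e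
...   | inj₂ ([] , refl , refl) = ⊥-elim (<-irrefl refl (Occurrence-low< o (λ i → m-max (StackSort-∈⁻ S i))))
...   | inj₂ (_ ∷ r , refl , e′) with () ← ++-conicalʳ r (x ∷ q) (sym (∷-injectiveʳ e′))
...   | inj₁ (q″ , refl , refl) with ⊆-++-split Sα p′ t
...     | w₁ , z ∷ _ , refl , _ , t₂ = ⊥-elim (n321 (++⁺ˡ α (refl ∷ zx⊆β)) (β<m (head∈ zx⊆β)) x<z)
  where
  open BelowMax m-max u
  x<z : x < z
  x<z = All.lookup above (∈-++⁺ʳ w₁ (here refl))
  zx⊆β : z ∷ x ∷ [] ⊆ β
  zx⊆β = StackSort-reflects-decreasing sβ ((x<z ∷ []) ∷ [] ∷ []) (++⁺ (from∈ (head∈ t₂)) (refl ∷ []⊆-universal q″))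
...     | w₁ , [] , refl , t₁ , _ =
  subst (Occurrence (suc j)) (++-assoc α [ m ] β)
    (Occurrence-++ (α ++ [ m ]) (++⁺ w₁⊆α ⊆-refl)
      (AllPairs.++⁺ inc₁ ([] ∷ []) (All.tabulate λ i → α<m (∈-resp-⊆ w₁⊆α i) ∷ []))
      (All.++⁺ above₁ (β<m x∈β ∷ []))
      (subst (suc j <_) (sym (trans (length-++ w₁) (+-comm (length w₁) 1))) (s≤s long₁))
      x∈β)
  where
  open BelowMax m-max u
  inc₁ : AllPairs _<_ w₁
  inc₁ = AllPairs-resp-⊆ (++⁺ʳ [] ⊆-refl) inc
  above₁ : All (x <_) w₁
  above₁ = All.++⁻ˡ w₁ above
  long₁ : j < length w₁
  long₁ = subst (j <_) (trans (length-++ w₁) (+-identityʳ (length w₁))) long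
  x∈β : x ∈ β
  x∈β = StackSort-∈⁻ sβ (∈-++⁺ʳ p′ (here refl))
  w₁⊆α : w₁ ⊆ α
  w₁⊆α = increasing-⊆ α inc₁ (λ i → StackSort-∈⁻ sα (∈-resp-⊆ t₁ i))
    (λ s b<a _ b∈w₁ → n321 (++⁺ s (m ∷ʳ from∈ x∈β)) b<a (All.lookup above₁ b∈w₁))

increasing⇒¬Occurrence : ∀ {k ρ} → AllPairs _<_ ρ → ¬ Occurrence k ρ
increasing⇒¬Occurrence ρ↑ (occurrence {after = q} {ascent = _ ∷ _} refl s _ (x<y ∷ _) _) =
  <-asym x<y (AllPairs-pair (++⁺ (from∈ (head∈ s)) (refl ∷ []⊆-universal q)) ρ↑)

¬Occurrence⇒increasing : ∀ {ρ} → Unique ρ → ¬ Occurrence 0 ρ → AllPairs _<_ ρ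
¬Occurrence⇒increasing {[]} _ _ = []
¬Occurrence⇒increasing {r ∷ ρ} (r∉ρ ∷ u) ¬o =
  All.tabulate r<z ∷ ¬Occurrence⇒increasing u (¬o ∘′ Occurrence-∷ r)
  where
  r<z : ∀ {z} → z ∈ ρ → r < z
  r<z {z} i with <-cmp r z
  ... | tri< r<z _ _ = r<z
  ... | tri≈ _ r≡z _ = ⊥-elim (All.lookup r∉ρ i r≡z)
  ... | tri> _ _ z<r = ⊥-elim (¬o (Occurrence-++ [ r ] ⊆-refl ([] ∷ []) (z<r ∷ []) (s≤s z≤n) i))

stackSortIter-suc : ∀ t ρ → stackSortIter (suc t) ρ ≡ stackSortIter t (stackSort ρ)
stackSortIter-suc zero ρ = refl
stackSortIter-suc (suc t) ρ = cong stackSort (stackSortIter-suc t ρ)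

stackSortIter≡idPerm⇔¬Occurrence : ∀ t {n ρ} → ρ ↭ idPerm n → No321 ρ →
  (stackSortIter t ρ ≡ idPerm n) ⇔ (¬ Occurrence t ρ)
stackSortIter≡idPerm⇔¬Occurrence zero {n} p _ = mk⇔
  (λ { refl → increasing⇒¬Occurrence (idPerm-increasing n) })
  (λ ¬o → ↭-idPerm-increasing⇒≡ p (¬Occurrence⇒increasing (↭-idPerm⇒Unique p) ¬o))
stackSortIter≡idPerm⇔¬Occurrence (suc t) {n} {ρ} p n321 = mk⇔
  (λ e o → to IH (trans (sym (stackSortIter-suc t ρ)) e) (occurrence-after-StackSort S u n321 o))
  (λ ¬o → trans (stackSortIter-suc t ρ) (from IH (λ o → ¬o (occurrence-before-StackSort S u n321 o))))
  where
  S = stackSort-graph ρ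
  u = ↭-idPerm⇒Unique p
  IH = stackSortIter≡idPerm⇔¬Occurrence t (↭-trans (StackSort-↭ S) p) (StackSort-preserves-No321 S n321)

at-++ˡ : ∀ (xs ys : List ℕ) {i} → i < length xs → at (xs ++ ys) i ≡ at xs i
at-++ˡ (x ∷ xs) ys {zero} _ = refl
at-++ˡ (x ∷ xs) ys {suc i} (s≤s i<n) = at-++ˡ xs ys i<n

at-++-∷ : ∀ (xs : List ℕ) x ys → at (xs ++ x ∷ ys) (length xs) ≡ x
at-++-∷ [] x ys = refl
at-++-∷ (_ ∷ xs) x ys = at-++-∷ xs x ys

at-++-∷-suc : ∀ (p : List ℕ) x q i → at (p ++ x ∷ q) (suc (length p) + i) ≡ at q i
at-++-∷-suc [] x q i = refl
at-++-∷-suc (_ ∷ p) x q i = at-++-∷-suc p x q i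

at∈ : ∀ (xs : List ℕ) {i} → i < length xs → at xs i ∈ xs
at∈ (x ∷ xs) {zero} _ = here refl
at∈ (x ∷ xs) {suc i} (s≤s i<n) = there (at∈ xs i<n)

∈⇒at : ∀ {z : ℕ} {xs} → z ∈ xs → ∃ λ i → i < length xs × at xs i ≡ z
∈⇒at (here refl) = 0 , s≤s z≤n , refl
∈⇒at (there z∈xs) with ∈⇒at z∈xs
... | i , i<n , refl = suc i , s≤s i<n , refl

at-split : ∀ (xs : List ℕ) {j} → j < length xs → ∃₂ λ p q → xs ≡ p ++ at xs j ∷ q × length p ≡ j
at-split (x ∷ xs) {zero} _ = [] , xs , refl , refl
at-split (x ∷ xs) {suc j} (s≤s j<n) with at-split xs j<n
... | p , q , e , |p|≡j = x ∷ p , q , cong (x ∷_) e , cong suc |p|≡j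

at⇒All : ∀ {P : ℕ → Set} xs → (∀ {i} → i < length xs → P (at xs i)) → All P xs
at⇒All xs P-at = All.tabulate λ z∈xs → case ∈⇒at z∈xs of λ { (i , i<n , refl) → P-at i<n }

AllPairs⇒at : ∀ {R : ℕ → ℕ → Set} {xs} → AllPairs R xs →
  ∀ {i j} → i < j → j < length xs → R (at xs i) (at xs j)
AllPairs⇒at {xs = x ∷ xs} (x~xs ∷ _) {zero} {suc j} _ (s≤s j<n) = All.lookup x~xs (at∈ xs j<n)
AllPairs⇒at {xs = x ∷ xs} (_ ∷ R-xs) {suc i} {suc j} (s≤s i<j) (s≤s j<n) = AllPairs⇒at R-xs i<j j<n

at⇒AllPairs : ∀ {R : ℕ → ℕ → Set} xs →
  (∀ {i j} → i < j → j < length xs → R (at xs i) (at xs j)) → AllPairs R xs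
at⇒AllPairs [] _ = []
at⇒AllPairs (x ∷ xs) R-at =
  at⇒All xs (λ j<n → R-at {0} (s≤s z≤n) (s≤s j<n)) ∷ at⇒AllPairs xs (λ i<j j<n → R-at (s≤s i<j) (s≤s j<n))

at-<⇔ : ∀ {xs i j} → AllPairs _<_ xs → i < length xs → j < length xs → (at xs i < at xs j) ⇔ (i < j)
at-<⇔ {i = i} {j} xs↑ i<n j<n = mk⇔ index< (λ i<j → AllPairs⇒at xs↑ i<j j<n)
  where
  index< : _ → i < j
  index< lt with <-cmp i j
  ... | tri< i<j _ _ = i<j
  ... | tri≈ _ refl _ = ⊥-elim (<-irrefl refl lt)
  ... | tri> _ _ j<i = ⊥-elim (<-asym lt (AllPairs⇒at xs↑ j<i i<n))

at->⇔ : ∀ {xs i j} → AllPairs _>_ xs → i < length xs → j < length xs → (at xs i < at xs j) ⇔ (j < i)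
at->⇔ {i = i} {j} xs↓ i<n j<n = mk⇔ index> (λ j<i → AllPairs⇒at xs↓ j<i i<n)
  where
  index> : _ → j < i
  index> lt with <-cmp i j
  ... | tri< i<j _ _ = ⊥-elim (<-asym lt (AllPairs⇒at xs↓ i<j j<n))
  ... | tri≈ _ refl _ = ⊥-elim (<-irrefl refl lt)
  ... | tri> _ _ j<i = j<i

OrderIso-via : ∀ {σ p} (_≺_ : ℕ → ℕ → Set) → length σ ≡ length p →
  (∀ {i j} → i < length σ → j < length σ → (at σ i < at σ j) ⇔ (i ≺ j)) →
  (∀ {i j} → i < length p → j < length p → (at p i < at p j) ⇔ (i ≺ j)) → OrderIso σ p
OrderIso-via _≺_ σ≡p σ-cmp p-cmp = σ≡p , λ i j i<n j<n →
  ⇔-trans (σ-cmp i<n j<n) (⇔-sym (p-cmp (subst (i <_) σ≡p i<n) (subst (j <_) σ≡p j<n)))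

OrderIso-transfer : ∀ {σ p} {_≺_ : ℕ → ℕ → Set} → OrderIso σ p →
  (∀ {i j} → i < length p → j < length p → (at p i < at p j) ⇔ (i ≺ j)) →
  (∀ {i j} → i < length σ → j < length σ → (at σ i < at σ j) ⇔ (i ≺ j))
OrderIso-transfer (σ≡p , iso) p-cmp {i} {j} i<n j<n =
  ⇔-trans (iso i j i<n j<n) (p-cmp (subst (i <_) σ≡p i<n) (subst (j <_) σ≡p j<n))

Avoids321⇒No321 : ∀ {π} → Avoids π p321 → No321 π
Avoids321⇒No321 av t b<a c<b = av (_ , t , OrderIso-via (λ i j → j < i) refl
  (at->⇔ ((b<a ∷ <-trans c<b b<a ∷ []) ∷ (c<b ∷ []) ∷ [] ∷ []))
  (at->⇔ ((≤-refl ∷ s≤s (s≤s z≤n) ∷ []) ∷ (≤-refl ∷ []) ∷ [] ∷ [])))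

ascent-low-<⇔ : ∀ {zs x i j} → AllPairs _<_ zs → All (x <_) zs →
  i < length (zs ++ [ x ]) → j < length (zs ++ [ x ]) →
  (at (zs ++ [ x ]) i < at (zs ++ [ x ]) j) ⇔ (j < length zs × (i < j ⊎ i ≡ length zs))
ascent-low-<⇔ {zs} {x} {i} {j} zs↑ above i<n+1 j<n+1
  with m<1+n⇒m<n∨m≡n (subst (i <_) (length-snoc zs x) i<n+1)
     | m<1+n⇒m<n∨m≡n (subst (j <_) (length-snoc zs x) j<n+1)
... | inj₁ i<n | inj₁ j<n rewrite at-++ˡ zs [ x ] i<n | at-++ˡ zs [ x ] j<n =
  ⇔-trans (at-<⇔ zs↑ i<n j<n) (mk⇔ (λ i<j → j<n , inj₁ i<j)
    λ { (_ , inj₁ i<j) → i<j ; (_ , inj₂ refl) → ⊥-elim (<-irrefl refl i<n) })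
... | inj₁ i<n | inj₂ refl rewrite at-++ˡ zs [ x ] i<n | at-++-∷ zs x [] =
  mk⇔ (λ zᵢ<x → ⊥-elim (<-asym zᵢ<x (All.lookup above (at∈ zs i<n)))) (λ (n<n , _) → ⊥-elim (<-irrefl refl n<n))
... | inj₂ refl | inj₁ j<n rewrite at-++-∷ zs x [] | at-++ˡ zs [ x ] j<n =
  mk⇔ (λ _ → j<n , inj₂ refl) (λ _ → All.lookup above (at∈ zs j<n))
... | inj₂ refl | inj₂ refl = mk⇔ (λ x<x → ⊥-elim (<-irrefl refl x<x)) (λ (n<n , _) → ⊥-elim (<-irrefl refl n<n))

OrderIso-ascent-low : ∀ {zs x ws w} → length zs ≡ length ws → AllPairs _<_ ws → All (w <_) ws →
  OrderIso (zs ++ [ x ]) (ws ++ [ w ]) ⇔ (AllPairs _<_ zs × All (x <_) zs)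
OrderIso-ascent-low {zs} {x} {ws} {w} zs≡ws ws↑ ws-above = mk⇔ ascent-low (λ (zs↑ , above) →
  OrderIso-via {zs ++ [ x ]} {ws ++ [ w ]} _≺_ (trans (length-snoc zs x) (trans (cong suc zs≡ws) (sym (length-snoc ws w))))
    (ascent-low-<⇔ zs↑ above) ws-cmp)
  where
  _≺_ : ℕ → ℕ → Set
  i ≺ j = j < length zs × (i < j ⊎ i ≡ length zs)
  ws-cmp : ∀ {i j} → i < length (ws ++ [ w ]) → j < length (ws ++ [ w ]) →
    (at (ws ++ [ w ]) i < at (ws ++ [ w ]) j) ⇔ (i ≺ j)
  ws-cmp {i} {j} i<n j<n =
    subst (λ n → _ ⇔ (j < n × (i < j ⊎ i ≡ n))) (sym zs≡ws) (ascent-low-<⇔ ws↑ ws-above i<n j<n)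
  ascent-low : OrderIso (zs ++ [ x ]) (ws ++ [ w ]) → AllPairs _<_ zs × All (x <_) zs
  ascent-low iso = at⇒AllPairs zs (λ {i} {j} i<j j<n →
      subst₂ _<_ (at-++ˡ zs [ x ] (<-trans i<j j<n)) (at-++ˡ zs [ x ] j<n)
        (from (zs-cmp (inside (<-trans i<j j<n)) (inside j<n)) (j<n , inj₁ i<j)))
    , at⇒All zs (λ {j} j<n →
      subst₂ _<_ (at-++-∷ zs x []) (at-++ˡ zs [ x ] j<n)
        (from (zs-cmp (subst (length zs <_) (sym (length-snoc zs x)) ≤-refl) (inside j<n)) (j<n , inj₂ refl)))
    where
    zs-cmp = OrderIso-transfer {zs ++ [ x ]} {ws ++ [ w ]} iso ws-cmp
    inside : ∀ {i} → i < length zs → i < length (zs ++ [ x ])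
    inside i<n = subst (_ <_) (sym (length-snoc zs x)) (m≤n⇒m≤1+n i<n)

pat-ascent : ℕ → List ℕ
pat-ascent t = map (2 +_) (upTo (suc t))

pat-ascent-increasing : ∀ t → AllPairs _<_ (pat-ascent t)
pat-ascent-increasing t =
  AllPairs.map⁺ (AllPairs.map (λ i<j → s≤s (s≤s i<j)) (AllPairs.applyUpTo⁺₁ (λ i → i) (suc t) (λ i<j _ → i<j)))

pat-ascent-above : ∀ t → All (1 <_) (pat-ascent t)
pat-ascent-above t = All.map⁺ (All.tabulate (λ _ → s≤s (s≤s z≤n)))

length-pat-ascent : ∀ t → length (pat-ascent t) ≡ suc t
length-pat-ascent t = trans (length-map (2 +_) (upTo (suc t))) (length-upTo (suc t))

Contains⇒Occurrence : ∀ {t π} → Contains π (pat t) → Occurrence t π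
Contains⇒Occurrence {t} (σ , σ⊆π , iso) with initLast σ
... | [] with () ← proj₁ iso
... | ys ∷ʳ′ x with snoc-⊆ ys σ⊆π
...   | p , q , refl , ys⊆p = occurrence refl ys⊆p ys↑ above (≤-reflexive (sym |ys|≡1+t))
  where
  |ys|≡1+t : length ys ≡ suc t
  |ys|≡1+t = suc-injective (trans (sym (length-snoc ys x))
    (trans (proj₁ iso) (trans (length-snoc (pat-ascent t) 1) (cong suc (length-pat-ascent t)))))
  ys↑×above = to (OrderIso-ascent-low (trans |ys|≡1+t (sym (length-pat-ascent t)))
                   (pat-ascent-increasing t) (pat-ascent-above t)) iso
  ys↑ = proj₁ ys↑×above
  above = proj₂ ys↑×above

Occurrence⇒Contains : ∀ {t π} → Occurrence t π → Contains π (pat t)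
Occurrence⇒Contains {t} (occurrence {p} {x} {q} {ys} refl s ys↑ above long) =
  take (suc t) ys ++ [ x ] , ++⁺ (⊆-trans (take-⊆ (suc t) ys) s) (refl ∷ []⊆-universal q) ,
  from (OrderIso-ascent-low |zs|≡|ascent| (pat-ascent-increasing t) (pat-ascent-above t))
    (AllPairs.take⁺ (suc t) ys↑ , All-resp-⊆ (take-⊆ (suc t) ys) above)
  where
  |zs|≡|ascent| : length (take (suc t) ys) ≡ length (pat-ascent t)
  |zs|≡|ascent| = trans (length-take (suc t) ys) (trans (m≤n⇒m⊓n≡m long) (sym (length-pat-ascent t)))

mlw≤⇔ : ∀ π {t} → (mlw π ≤ t) ⇔ (∀ {j} → j < length π → T (isRmi π j) → suc j ∸ at π j ≤ t)
mlw≤⇔ π {t} = mk⇔ drops≤ (λ drops≤t → from (maxL≤⇔All _) (All.tabulate (≤drops drops≤t)))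
  where
  drop : ℕ → ℕ
  drop j = suc j ∸ at π j
  rmi? = λ j → T? (isRmi π j)
  drops = map drop (filterᵇ (isRmi π) (upTo (length π)))
  drops≤ : maxL drops ≤ t → ∀ {j} → j < length π → T (isRmi π j) → drop j ≤ t
  drops≤ mlw≤t j<n rmi = ≤-trans (≤maxL (∈-map⁺ drop (∈-filter⁺ rmi? (∈-upTo⁺ j<n) rmi))) mlw≤t
  ≤drops : (∀ {j} → j < length π → T (isRmi π j) → drop j ≤ t) → ∀ {d} → d ∈ drops → d ≤ t
  ≤drops drops≤t d∈drops with ∈-map⁻ drop d∈drops
  ... | j , j∈rmis , refl with ∈-filter⁻ rmi? j∈rmis
  ...   | j∈upTo , rmi = drops≤t (∈-upTo⁻ j∈upTo) rmi

allB-true : ∀ p xs → All (λ x → T (p x)) xs → T (allB p xs)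
allB-true p [] [] = tt
allB-true p (x ∷ xs) (px ∷ pxs) rewrite to T-≡ px = allB-true p xs pxs

isRmi-++-∷ : ∀ p x q → All (x <_) q → T (isRmi (p ++ x ∷ q) (length p))
isRmi-++-∷ p x q x<q = allB-true (λ k → at π (length p) <ᵇ at π k) later (All.tabulate λ k∈later →
  case ∈-applyUpTo⁻ (λ i → suc (length p) + i) k∈later of λ { (i , i<|q| , refl) →
  subst₂ (λ a b → T (a <ᵇ b)) (sym (at-++-∷ p x q)) (sym (at-++-∷-suc p x q i))
    (<⇒<ᵇ (All.lookup x<q (at∈ q (subst (i <_) |later|≡|q| i<|q|)))) })
  where
  π = p ++ x ∷ q
  later = applyUpTo (λ i → suc (length p) + i) (length π ∸ suc (length p))
  |later|≡|q| : length (p ++ x ∷ q) ∸ suc (length p) ≡ length q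
  |later|≡|q| = trans (cong (_∸ suc (length p)) (trans (length-++-sucʳ p x q) (cong suc (length-++ p))))
                      (m+n∸m≡n (length p) (length q))

split-drop⇒Occurrence : ∀ {n t} p x q → p ++ x ∷ q ↭ idPerm n → No321 (p ++ x ∷ q) →
  t < suc (length p) ∸ x → Occurrence t (p ++ x ∷ q)
split-drop⇒Occurrence {n} {t} p x q perm n321 t<drop
  with ∈-idPerm⁻ (∈-resp-↭ perm (∈-++⁺ʳ p (here refl)))
... | s≤s {n = x′} z≤n , _ = Occurrence-++ p B⊆p B↑ B-above long (here refl)
  where
  B = filter (x <?_) p
  B⊆p = filter-⊆ (x <?_) p
  B-above : All (x <_) B
  B-above = All.all-filter (x <?_) p
  u = ↭-idPerm⇒Unique perm
  u-p : Unique p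
  u-p = AllPairs-resp-⊆ (++⁺ʳ (x ∷ q) ⊆-refl) u
  B↑ : AllPairs _<_ B
  B↑ = above-before-No321 (No321-resp-⊆ (++⁺ B⊆p (refl ∷ []⊆-universal q)) n321) (AllPairs-resp-⊆ B⊆p u-p) B-above
  covered : ∀ {z} → z ∈ p → z ∈ idPerm x′ ++ B
  covered {z} z∈p with x <? z
  ... | yes x<z = ∈-++⁺ʳ (idPerm x′) (∈-filter⁺ (x <?_) z∈p x<z)
  ... | no x≮z = ∈-++⁺ˡ (∈-idPerm⁺ (proj₁ (∈-idPerm⁻ (∈-resp-↭ perm (∈-++⁺ˡ z∈p))))
                   (≤-pred (≤∧≢⇒< (≮⇒≥ x≮z) (AllPairs-pair (pair-⊆-++ z∈p (here refl)) u))))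
  |p|≤x′+|B| : length p ≤ x′ + length B
  |p|≤x′+|B| = subst (length p ≤_) (trans (length-++ (idPerm x′)) (cong (_+ length B) (length-idPerm x′)))
                (Unique⇒length-mono u-p covered)
  long : t < length B
  long = <-≤-trans t<drop (m≤n+o⇒m∸n≤o (length p) x′ |p|≤x′+|B|)

drop⇒Occurrence : ∀ {n π t j} → π ↭ idPerm n → No321 π → j < length π → t < suc j ∸ at π j → Occurrence t π
drop⇒Occurrence {π = π} perm n321 j<n t<drop with at-split π j<n
... | p , q , split , refl = subst (Occurrence _) (sym split)
  (split-drop⇒Occurrence p _ q (subst (_↭ _) split perm) (subst No321 split n321) t<drop)

Occurrence⇒drop : ∀ {n π t} → π ↭ idPerm n → No321 π → Occurrence t π →
  ∃ λ j → j < length π × T (isRmi π j) × t < suc j ∸ at π j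
Occurrence⇒drop {n} {t = t} perm n321 (occurrence {p} {x} {q} {y ∷ ys} refl ys⊆p ys↑ ys-above long)
  with ∈-idPerm⁻ (∈-resp-↭ perm (∈-++⁺ʳ p (here refl)))
... | s≤s {n = x′} z≤n , x≤n =
  length p , j<n , isRmi-++-∷ p x q q-above ,
  subst (λ a → t < suc (length p) ∸ a) (sym (at-++-∷ p x q))
    (<-≤-trans long (m+n≤o⇒m≤o∸n (length (y ∷ ys)) |ys|+x′≤|p|))
  where
  u = ↭-idPerm⇒Unique perm
  j<n : length p < length (p ++ x ∷ q)
  j<n = subst (length p <_) (sym (trans (length-++-sucʳ p x q) (cong suc (length-++ p)))) (s≤s (m≤m+n _ _))
  q-above : All (x <_) q
  q-above = All.tabulate λ {z} z∈q → case <-cmp x z of λ where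
    (tri< x<z _ _) → x<z
    (tri≈ _ refl _) → ⊥-elim (AllPairs-pair (++⁺ˡ p (refl ∷ from∈ z∈q)) u refl)
    (tri> _ _ z<x) → ⊥-elim (n321 (++⁺ (from∈ (head∈ ys⊆p)) (refl ∷ from∈ z∈q)) (All.lookup ys-above (here refl)) z<x)
  below : ∀ {z} → z ∈ idPerm x′ → z < x
  below z∈ = s≤s (proj₂ (∈-idPerm⁻ z∈))
  u-covering : Unique ((y ∷ ys) ++ idPerm x′)
  u-covering = AllPairs.++⁺ (AllPairs.map <⇒≢ ys↑) (AllPairs.map <⇒≢ (idPerm-increasing x′))
    (All.tabulate λ a∈ys → All.tabulate λ b∈ → λ a≡b →
      <-asym (All.lookup ys-above a∈ys) (subst (_< x) (sym a≡b) (below b∈)))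
  covered : ∀ {z} → z ∈ (y ∷ ys) ++ idPerm x′ → z ∈ p
  covered {z} z∈ with ∈-++⁻ (y ∷ ys) z∈
  ... | inj₁ z∈ys = ∈-resp-⊆ ys⊆p z∈ys
  ... | inj₂ z∈id with ∈-++⁻ p (∈-resp-↭ (↭-sym perm)
                        (∈-idPerm⁺ (proj₁ (∈-idPerm⁻ z∈id)) (≤-trans (<⇒≤ (below z∈id)) x≤n)))
  ...   | inj₁ z∈p = z∈p
  ...   | inj₂ (here refl) = ⊥-elim (<-irrefl refl (below z∈id))
  ...   | inj₂ (there z∈q) = ⊥-elim (<-asym (below z∈id) (All.lookup q-above z∈q))
  |ys|+x′≤|p| : length (y ∷ ys) + x′ ≤ length p
  |ys|+x′≤|p| = subst (_≤ length p) (trans (length-++ (y ∷ ys)) (cong (length (y ∷ ys) +_) (length-idPerm x′)))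
                  (Unique⇒length-mono u-covering covered)

proposition4p2 : (t : ℕ) → 1 ≤ t → (n : ℕ) →
    ((π : List ℕ) → Av321 n π → (Avoids π (pat t) ⇔ (mlw π ≤ t)))
    × ((π : List ℕ) → Sorted321 t n π ⇔ (Av321 n π × Avoids π (pat t)))
proposition4p2 t _ n = avoids⇔mlw≤ , sorted⇔avoids
  where
  avoids⇔mlw≤ : (π : List ℕ) → Av321 n π → (Avoids π (pat t) ⇔ (mlw π ≤ t))
  avoids⇔mlw≤ π (perm , av321) = mk⇔
    (λ av → from (mlw≤⇔ π) λ j<n _ → ≮⇒≥ λ t<drop →
      av (Occurrence⇒Contains (drop⇒Occurrence perm n321 j<n t<drop)))
    (λ mlw≤t c → let (j , j<n , rmi , t<drop) = Occurrence⇒drop perm n321 (Contains⇒Occurrence c)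
                 in <⇒≱ t<drop (to (mlw≤⇔ π) mlw≤t j<n rmi))
    where n321 = Avoids321⇒No321 av321
  sorted⇔avoids : (π : List ℕ) → Sorted321 t n π ⇔ (Av321 n π × Avoids π (pat t))
  sorted⇔avoids π = mk⇔
    (λ ((perm , av321) , sorted) → (perm , av321) ,
      λ c → to (iterate⇔ perm av321) sorted (Contains⇒Occurrence c))
    (λ ((perm , av321) , av) → (perm , av321) ,
      from (iterate⇔ perm av321) (λ o → av (Occurrence⇒Contains o)))
    where
    iterate⇔ = λ perm av321 → stackSortIter≡idPerm⇔¬Occurrence t {n} {π} perm (Avoids321⇒No321 av321)
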